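{- Let $G$ be a bipartite graph such that $\delta(G)>\widetilde{\alpha}(G)$. Then $G$ is $(\delta(G)-\widetilde{\alpha}(G))$-connected.
   Context: $\delta(G)$ is the minimum degree. For a bipartite graph $G$ with bipartition $(V_1,V_2)$, $\widetilde{\alpha}(G)$ is the maximum integer $k$ such that there exist $k$-sets $S_1\subseteq V_1$, $S_2\subseteq V_2$ with no edges between $S_1$ and $S_2$. A graph is $t$-connected if removing any set of fewer than $t$ vertices leaves a connected graph. -}

module Defs where

open import Data.Nat using (ℕ; zero; suc; _+_; _≤_; _<_)
open import Data.Bool using (Bool; true; false)
open import Data.Fin using (Fin)
open import Data.Fin.Subset using (Subset; _∈_; _∉_; ∣_∣)
open import Data.Sum using (_⊎_; inj₁; inj₂)
open import Data.Product using (Σ; _×_; ∃-syntax)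
open import Data.Empty using (⊥)
open import Relation.Binary.PropositionalEquality using (_≡_)

count : {n : ℕ} → (Fin n → Bool) → ℕ
count {zero} f = 0
count {suc n} f with f Fin.zero
... | true  = suc (count (λ i → f (Fin.suc i)))
... | false = count (λ i → f (Fin.suc i))

record BipGraph : Set where
  field
    a b : ℕ
    E   : Fin a → Fin b → Bool

module _ (G : BipGraph) where
  open BipGraph G

  Vertex : Set
  Vertex = Fin a ⊎ Fin b

  Adj : Vertex → Vertex → Set
  Adj (inj₁ x) (inj₂ y) = E x y ≡ true
  Adj (inj₂ y) (inj₁ x) = E x y ≡ true
  Adj (inj₁ _) (inj₁ _) = ⊥
  Adj (inj₂ _) (inj₂ _) = ⊥

  degree : Vertex → ℕ
  degree (inj₁ x) = count (λ y → E x y)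
  degree (inj₂ y) = count (λ x → E x y)

  IsMinDegree : ℕ → Set
  IsMinDegree d = (∀ v → d ≤ degree v) × ∃[ v ] degree v ≡ d

  HasBiIndep : ℕ → Set
  HasBiIndep k = ∃[ S₁ ] ∃[ S₂ ]
    (∣ S₁ ∣ ≡ k × ∣ S₂ ∣ ≡ k ×
     (∀ (x : Fin a) (y : Fin b) → x ∈ S₁ → y ∈ S₂ → E x y ≡ false))

  IsAlphaTilde : ℕ → Set
  IsAlphaTilde k = HasBiIndep k × (∀ k′ → HasBiIndep k′ → k′ ≤ k)

  InX : Subset a → Subset b → Vertex → Set
  InX X₁ X₂ (inj₁ x) = x ∈ X₁
  InX X₁ X₂ (inj₂ y) = y ∈ X₂

  data Reach (X₁ : Subset a) (X₂ : Subset b) : Vertex → Vertex → Set where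
    here : ∀ {u} → Reach X₁ X₂ u u
    step : ∀ {u w v} → Adj u w → (InX X₁ X₂ w → ⊥) →
           Reach X₁ X₂ w v → Reach X₁ X₂ u v

  ConnectedMinus : Subset a → Subset b → Set
  ConnectedMinus X₁ X₂ = ∀ u v → (InX X₁ X₂ u → ⊥) → (InX X₁ X₂ v → ⊥) →
                         Reach X₁ X₂ u v

  IsConnectedK : ℕ → Set
  IsConnectedK t = ∀ (X₁ : Subset a) (X₂ : Subset b) →
                   ∣ X₁ ∣ + ∣ X₂ ∣ < t → ConnectedMinus X₁ X₂

-- Delete a set X with |X| + α̃ < δ. Every remaining vertex keeps more than α̃
-- neighbours outside X. For x ∈ V₁ and y ∈ V₂ outside X, the residual
-- neighbourhoods N(y) − X₁ and N(x) − X₂ both have more than α̃ elements, so by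
-- maximality of α̃ some edge x′y′ runs between them, giving the walk x y′ x′ y
-- in G − X. Two vertices on the same side are joined through a residual
-- neighbour of one of them.
module Submission where

open import Defs
open import Data.Nat using (ℕ; zero; suc; _+_; _∸_; _≤_; _<_; z≤n; s≤s)
open import Data.Nat.Properties
open import Data.Bool using (Bool; true; false)
open import Data.Bool.Properties using (¬-not) renaming (_≟_ to _≟ᵇ_)
open import Data.Fin using (Fin)
open import Data.Fin.Subset
  using (Subset; inside; outside; _∈_; _∉_; _⊆_; _─_; ∣_∣; Nonempty)
  renaming (⊥ to ∅)
open import Data.Fin.Subset.Properties using (_∈?_; ⊥⊆; ∣⊥∣≡0; in⊆in; s⊆s; p─q⊆p)
open import Data.Fin.Properties using (any?)
open import Data.Vec using ([]; _∷_; tabulate; here; there)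
open import Data.Vec.Properties using ([]=⇒lookup; lookup∘tabulate)
open import Data.Sum using (inj₁; inj₂)
open import Data.Product using (_×_; _,_; ∃-syntax)
open import Relation.Nullary using (¬_; yes; no; contradiction)
open import Relation.Nullary.Decidable using (_×-dec_)
open import Relation.Binary.PropositionalEquality using (_≡_; refl; sym; trans; cong)

∣tabulate∣≡count : ∀ {n} (f : Fin n → Bool) → ∣ tabulate f ∣ ≡ count f
∣tabulate∣≡count {zero}  f = refl
∣tabulate∣≡count {suc n} f with f Fin.zero
... | true  = cong suc (∣tabulate∣≡count (λ i → f (Fin.suc i)))
... | false = ∣tabulate∣≡count (λ i → f (Fin.suc i))

∈tabulate⇒true : ∀ {n} {f : Fin n → Bool} {i} → i ∈ tabulate f → f i ≡ true
∈tabulate⇒true {f = f} {i} i∈ = trans (sym (lookup∘tabulate f i)) ([]=⇒lookup i∈)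

x∈p─q⇒x∉q : ∀ {n} (p q : Subset n) {x} → x ∈ p ─ q → x ∉ q
x∈p─q⇒x∉q (inside ∷ p) (outside ∷ q) here ()
x∈p─q⇒x∉q (_ ∷ p)      (_ ∷ q)       (there x∈) (there x∈q) = x∈p─q⇒x∉q p q x∈ x∈q

∣p∣≤∣p─q∣+∣q∣ : ∀ {n} (p q : Subset n) → ∣ p ∣ ≤ ∣ p ─ q ∣ + ∣ q ∣
∣p∣≤∣p─q∣+∣q∣ []            []            = z≤n
∣p∣≤∣p─q∣+∣q∣ (inside  ∷ p) (inside  ∷ q) =
  ≤-trans (s≤s (∣p∣≤∣p─q∣+∣q∣ p q)) (≤-reflexive (sym (+-suc _ _)))
∣p∣≤∣p─q∣+∣q∣ (inside  ∷ p) (outside ∷ q) = s≤s (∣p∣≤∣p─q∣+∣q∣ p q)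
∣p∣≤∣p─q∣+∣q∣ (outside ∷ p) (inside  ∷ q) =
  ≤-trans (∣p∣≤∣p─q∣+∣q∣ p q) (+-monoʳ-≤ _ (n≤1+n _))
∣p∣≤∣p─q∣+∣q∣ (outside ∷ p) (outside ∷ q) = ∣p∣≤∣p─q∣+∣q∣ p q

∣q∣+k<∣p∣⇒k<∣p─q∣ : ∀ {n k} (p q : Subset n) → ∣ q ∣ + k < ∣ p ∣ → k < ∣ p ─ q ∣
∣q∣+k<∣p∣⇒k<∣p─q∣ p q lt = +-cancelˡ-< ∣ q ∣ _ _
  (<-≤-trans lt (≤-trans (∣p∣≤∣p─q∣+∣q∣ p q) (≤-reflexive (+-comm _ ∣ q ∣))))

0<∣p∣⇒Nonempty : ∀ {n} (p : Subset n) → 0 < ∣ p ∣ → Nonempty p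
0<∣p∣⇒Nonempty (inside  ∷ p) _  = Fin.zero , here
0<∣p∣⇒Nonempty (outside ∷ p) lt with 0<∣p∣⇒Nonempty p lt
... | i , i∈p = Fin.suc i , there i∈p

⊆-withSize : ∀ {n} (p : Subset n) m → m ≤ ∣ p ∣ → ∃[ q ] q ⊆ p × ∣ q ∣ ≡ m
⊆-withSize {n} p         zero    _       = ∅ , ⊥⊆ , ∣⊥∣≡0 n
⊆-withSize (inside  ∷ p) (suc m) (s≤s m≤) with ⊆-withSize p m m≤
... | q , q⊆p , ∣q∣≡m = inside ∷ q , in⊆in q⊆p , cong suc ∣q∣≡m
⊆-withSize (outside ∷ p) (suc m) m<       with ⊆-withSize p (suc m) m<
... | q , q⊆p , ∣q∣≡m = outside ∷ q , s⊆s q⊆p , ∣q∣≡m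

module _ (G : BipGraph) where
  open BipGraph G

  N₁ : Fin a → Subset b
  N₁ x = tabulate (E x)

  N₂ : Fin b → Subset a
  N₂ y = tabulate (λ x → E x y)

  ∣N∣≡degree₁ : ∀ x → ∣ N₁ x ∣ ≡ degree G (inj₁ x)
  ∣N∣≡degree₁ x = ∣tabulate∣≡count (E x)

  ∣N∣≡degree₂ : ∀ y → ∣ N₂ y ∣ ≡ degree G (inj₂ y)
  ∣N∣≡degree₂ y = ∣tabulate∣≡count (λ x → E x y)

  ¬HasBiIndep⇒edge : ∀ {m} → ¬ HasBiIndep G m → (S₁ : Subset a) (S₂ : Subset b) →
                     m ≤ ∣ S₁ ∣ → m ≤ ∣ S₂ ∣ →
                     ∃[ x ] ∃[ y ] x ∈ S₁ × y ∈ S₂ × E x y ≡ true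
  ¬HasBiIndep⇒edge {m} noIndep S₁ S₂ m≤∣S₁∣ m≤∣S₂∣
    with ⊆-withSize S₁ m m≤∣S₁∣ | ⊆-withSize S₂ m m≤∣S₂∣
  ... | T₁ , T₁⊆S₁ , ∣T₁∣≡m | T₂ , T₂⊆S₂ , ∣T₂∣≡m
    with any? (λ x → any? (λ y → x ∈? T₁ ×-dec y ∈? T₂ ×-dec E x y ≟ᵇ true))
  ... | yes (x , y , x∈ , y∈ , e) = x , y , T₁⊆S₁ x∈ , T₂⊆S₂ y∈ , e
  ... | no noEdge = contradiction
          (T₁ , T₂ , ∣T₁∣≡m , ∣T₂∣≡m ,
           λ x y x∈ y∈ → ¬-not (λ e → noEdge (x , y , x∈ , y∈ , e)))
          noIndep

  Adj-sym : ∀ {u v} → Adj G u v → Adj G v u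
  Adj-sym {inj₁ _} {inj₂ _} e = e
  Adj-sym {inj₂ _} {inj₁ _} e = e

  module _ {X₁ : Subset a} {X₂ : Subset b} where

    Reach-trans : ∀ {u v w} → Reach G X₁ X₂ u v → Reach G X₁ X₂ v w → Reach G X₁ X₂ u w
    Reach-trans here              r = r
    Reach-trans (step e w∉X u⇝v) r = step e w∉X (Reach-trans u⇝v r)

    -- Reversing a walk turns its start, which need not avoid X, into an inner vertex.
    Reach-sym : ∀ {u v} → ¬ InX G X₁ X₂ u → Reach G X₁ X₂ u v → Reach G X₁ X₂ v u
    Reach-sym u∉X here              = here
    Reach-sym u∉X (step e w∉X w⇝v) = Reach-trans (Reach-sym w∉X w⇝v) (step (Adj-sym e) u∉X here)

module _ (G : BipGraph) (k : ℕ) (noIndep : ¬ HasBiIndep G (suc k))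
         (X₁ : Subset (BipGraph.a G)) (X₂ : Subset (BipGraph.b G))
         (dense : ∀ v → ∣ X₁ ∣ + ∣ X₂ ∣ + k < degree G v) where
  open BipGraph G

  k<∣N₁─X₂∣ : ∀ x → k < ∣ N₁ G x ─ X₂ ∣
  k<∣N₁─X₂∣ x = ∣q∣+k<∣p∣⇒k<∣p─q∣ (N₁ G x) X₂ (begin-strict
    ∣ X₂ ∣ + k           ≤⟨ +-monoˡ-≤ k (m≤n+m ∣ X₂ ∣ ∣ X₁ ∣) ⟩
    ∣ X₁ ∣ + ∣ X₂ ∣ + k  <⟨ dense (inj₁ x) ⟩
    degree G (inj₁ x)    ≡⟨ ∣N∣≡degree₁ G x ⟨
    ∣ N₁ G x ∣           ∎)
    where open ≤-Reasoning

  k<∣N₂─X₁∣ : ∀ y → k < ∣ N₂ G y ─ X₁ ∣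
  k<∣N₂─X₁∣ y = ∣q∣+k<∣p∣⇒k<∣p─q∣ (N₂ G y) X₁ (begin-strict
    ∣ X₁ ∣ + k           ≤⟨ +-monoˡ-≤ k (m≤m+n ∣ X₁ ∣ ∣ X₂ ∣) ⟩
    ∣ X₁ ∣ + ∣ X₂ ∣ + k  <⟨ dense (inj₂ y) ⟩
    degree G (inj₂ y)    ≡⟨ ∣N∣≡degree₂ G y ⟨
    ∣ N₂ G y ∣           ∎)
    where open ≤-Reasoning

  residualNeighbour₁ : ∀ x → ∃[ y ] E x y ≡ true × y ∉ X₂
  residualNeighbour₁ x with 0<∣p∣⇒Nonempty (N₁ G x ─ X₂) (≤-trans (s≤s z≤n) (k<∣N₁─X₂∣ x))
  ... | y , y∈ = y , ∈tabulate⇒true (p─q⊆p (N₁ G x) X₂ y∈) , x∈p─q⇒x∉q (N₁ G x) X₂ y∈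

  residualNeighbour₂ : ∀ y → ∃[ x ] E x y ≡ true × x ∉ X₁
  residualNeighbour₂ y with 0<∣p∣⇒Nonempty (N₂ G y ─ X₁) (≤-trans (s≤s z≤n) (k<∣N₂─X₁∣ y))
  ... | x , x∈ = x , ∈tabulate⇒true (p─q⊆p (N₂ G y) X₁ x∈) , x∈p─q⇒x∉q (N₂ G y) X₁ x∈

  reachAcross : ∀ x y → y ∉ X₂ → Reach G X₁ X₂ (inj₁ x) (inj₂ y)
  reachAcross x y y∉X₂
    with ¬HasBiIndep⇒edge G noIndep (N₂ G y ─ X₁) (N₁ G x ─ X₂) (k<∣N₂─X₁∣ y) (k<∣N₁─X₂∣ x)
  ... | x′ , y′ , x′∈ , y′∈ , e =
    step {w = inj₂ y′} (∈tabulate⇒true (p─q⊆p (N₁ G x) X₂ y′∈)) (x∈p─q⇒x∉q (N₁ G x) X₂ y′∈)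
      (step {w = inj₁ x′} e (x∈p─q⇒x∉q (N₂ G y) X₁ x′∈)
        (step {w = inj₂ y} (∈tabulate⇒true (p─q⊆p (N₂ G y) X₁ x′∈)) y∉X₂ here))

  connectedMinus : ConnectedMinus G X₁ X₂
  connectedMinus (inj₁ x) (inj₂ y) _    y∉X = reachAcross x y y∉X
  connectedMinus (inj₂ y) (inj₁ x) y∉X x∉X = Reach-sym G x∉X (reachAcross x y y∉X)
  connectedMinus (inj₁ x) (inj₁ x₀) _   x₀∉X with residualNeighbour₁ x₀
  ... | y₀ , e , y₀∉X = Reach-trans G (reachAcross x y₀ y₀∉X) (step e x₀∉X here)
  connectedMinus (inj₂ y) (inj₂ y₀) y∉X y₀∉X with residualNeighbour₂ y₀
  ... | x₀ , e , x₀∉X = Reach-trans G (Reach-sym G x₀∉X (reachAcross x₀ y y∉X)) (step e y₀∉X here)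

lemma17 : (G : BipGraph) (d k : ℕ) → IsMinDegree G d → IsAlphaTilde G k →
          k < d → IsConnectedK G (d ∸ k)
lemma17 G d k (d≤degree , _) (_ , maximal) k<d X₁ X₂ ∣X∣<d∸k =
  connectedMinus G k noIndep X₁ X₂ (λ v → <-≤-trans ∣X∣+k<d (d≤degree v))
  where
  noIndep : ¬ HasBiIndep G (suc k)
  noIndep indep = 1+n≰n (maximal (suc k) indep)

  ∣X∣+k<d : ∣ X₁ ∣ + ∣ X₂ ∣ + k < d
  ∣X∣+k<d = ≤-trans (+-monoˡ-≤ k ∣X∣<d∸k) (≤-reflexive (m∸n+n≡m (<⇒≤ k<d)))
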